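{- The graph $K_3\times P_4$ has a $(8;p,q)$-decomposition.
   Context: $P_k$ denotes a path of length $k$ (with $k$ edges, $k+1$ vertices), so $P_4$ is the path on $5$ vertices; $C_k$ denotes a cycle with $k$ edges; $K_n$ is the complete graph on $n$ vertices. The tensor product $G\times H$ has vertex set $V(G)\times V(H)$, with $(g_1,h_1)(g_2,h_2)$ an edge whenever $g_1g_2\in E(G)$ and $h_1h_2\in E(H)$. A graph $G$ has a $(8;p,q)$-decomposition if, for some nonnegative integers $p,q$ with $8(p+q)=|E(G)|$, the edge set of $G$ can be partitioned into $p$ copies of $P_8$ and $q$ copies of $C_8$. -}

module Defs where

open import Data.Nat using (ℕ; suc; NonZero)
open import Data.Nat.DivMod using (_mod_)
open import Data.Fin using (Fin; toℕ; inject₁) renaming (suc to fsuc)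
open import Data.Product using (Σ; _×_; _,_; ∃!)
open import Data.Sum using (_⊎_; inj₁; inj₂)
open import Relation.Binary.PropositionalEquality using (_≡_; _≢_)
open import Function.Definitions using (Injective)
open import Level using (0ℓ)

record Graph : Set₁ where
  field
    V   : Set
    Adj : V → V → Set
open Graph public

K : ℕ → Graph
K n = record { V = Fin n ; Adj = λ i j → i ≢ j }

-- Path P_k with k edges, on vertex set Fin (suc k): i ~ j iff |i - j| = 1.
P : ℕ → Graph
P k = record { V = Fin (suc k)
             ; Adj = λ i j → (toℕ j ≡ suc (toℕ i)) ⊎ (toℕ i ≡ suc (toℕ j)) }

-- Tensor (categorical) product G × H.
_⊗_ : Graph → Graph → Graph
G ⊗ H = record { V = V G × V H
               ; Adj = λ { (g₁ , h₁) (g₂ , h₂) → Adj G g₁ g₂ × Adj H h₁ h₂ } }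

next : ∀ {k} .{{_ : NonZero k}} → Fin k → Fin k
next {k} i = suc (toℕ i) mod k

record PathCopy (k : ℕ) (G : Graph) : Set where
  field
    vtx  : Fin (suc k) → V G
    inj  : Injective _≡_ _≡_ vtx
    adj  : ∀ (i : Fin k) → Adj G (vtx (inject₁ i)) (vtx (fsuc i))
  edge : Fin k → V G × V G
  edge i = vtx (inject₁ i) , vtx (fsuc i)

record CycleCopy (k : ℕ) .{{_ : NonZero k}} (G : Graph) : Set where
  field
    vtx  : Fin k → V G
    inj  : Injective _≡_ _≡_ vtx
    adj  : ∀ (i : Fin k) → Adj G (vtx i) (vtx (next i))
  edge : Fin k → V G × V G
  edge i = vtx i , vtx (next i)

SameEdge : ∀ {A : Set} → A × A → A × A → Set
SameEdge (a , b) (u , v) = (a ≡ u × b ≡ v) ⊎ (a ≡ v × b ≡ u)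

-- Edge occurrences in a family of p path copies and q cycle copies:
-- (which path, which edge) or (which cycle, which edge).
Occ : ℕ → ℕ → ℕ → Set
Occ k p q = (Fin p × Fin k) ⊎ (Fin q × Fin k)

occEdge : ∀ {k p q} .{{_ : NonZero k}} {G : Graph} →
          (Fin p → PathCopy k G) → (Fin q → CycleCopy k G) →
          Occ k p q → V G × V G
occEdge ps cs (inj₁ (c , i)) = PathCopy.edge (ps c) i
occEdge ps cs (inj₂ (c , i)) = CycleCopy.edge (cs c) i

record Decomposition (k p q : ℕ) .{{_ : NonZero k}} (G : Graph) : Set where
  field
    paths     : Fin p → PathCopy k G
    cycles    : Fin q → CycleCopy k G
    partition : ∀ (u v : V G) → Adj G u v →
                ∃! _≡_ (λ (o : Occ k p q) → SameEdge (occEdge paths cycles o) (u , v))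

HasDecomposition : (k : ℕ) .{{_ : NonZero k}} → Graph → Set
HasDecomposition k G = Σ ℕ (λ p → Σ ℕ (λ q → Decomposition k p q G))

{-# OPTIONS --safe #-}
-- K₃ × P₄ has 3·2·4 = 24 edges; the three walks listed in `route` are copies
-- of P₈ whose edges partition them, so it has an (8;3,0)-decomposition.
-- That they are paths, cover every edge and share none is a finite,
-- decidable check.
module Submission where

open import Data.Nat using (ℕ; suc; NonZero)
import Data.Nat as ℕ
open import Data.Fin using (Fin; toℕ; inject₁; #_) renaming (suc to fsuc; _≟_ to _≟ᶠ_)
open import Data.Fin.Properties using (all?; any?)
open import Data.Product using (_×_; _,_; ∃₂; ∃!)
open import Data.Product.Properties using (≡-dec)
open import Data.Sum using (inj₁; inj₂)
open import Data.Vec using (Vec; _∷_; []; lookup)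
open import Function.Definitions using (Injective)
open import Relation.Binary.Definitions using (Decidable; DecidableEquality)
open import Relation.Binary.PropositionalEquality using (_≡_; refl; cong)
open import Relation.Nullary using (Dec; yes; no)
open import Relation.Nullary.Decidable using (toWitness; map′; ¬?; _×-dec_; _⊎-dec_; _→-dec_)
open import Defs

SameEdge-sym : ∀ {A : Set} {e f : A × A} → SameEdge e f → SameEdge f e
SameEdge-sym (inj₁ (refl , refl)) = inj₁ (refl , refl)
SameEdge-sym (inj₂ (refl , refl)) = inj₂ (refl , refl)

SameEdge-trans : ∀ {A : Set} {e f g : A × A} → SameEdge e f → SameEdge f g → SameEdge e g
SameEdge-trans (inj₁ (refl , refl)) s = s
SameEdge-trans (inj₂ (refl , refl)) (inj₁ (refl , refl)) = inj₂ (refl , refl)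
SameEdge-trans (inj₂ (refl , refl)) (inj₂ (refl , refl)) = inj₁ (refl , refl)

SameEdge? : ∀ {A : Set} → DecidableEquality A → Decidable (SameEdge {A})
SameEdge? _≟_ (a , b) (u , v) = ((a ≟ u) ×-dec (b ≟ v)) ⊎-dec ((a ≟ v) ×-dec (b ≟ u))

module _ {k p : ℕ} .{{_ : NonZero k}} {G : Graph} (paths : Fin p → PathCopy k G) where

  pathEdge : Fin p → Fin k → V G × V G
  pathEdge c = PathCopy.edge (paths c)

  PathsCover : Set
  PathsCover = ∀ u v → Adj G u v → ∃₂ λ c i → SameEdge (pathEdge c i) (u , v)

  PathsEdgeDisjoint : Set
  PathsEdgeDisjoint = ∀ c i c′ i′ → SameEdge (pathEdge c i) (pathEdge c′ i′) → (c , i) ≡ (c′ , i′)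

  noCycles : Fin 0 → CycleCopy k G
  noCycles ()

  pathDecomposition : PathsCover → PathsEdgeDisjoint → Decomposition k p 0 G
  pathDecomposition cover disjoint = record
    { paths = paths ; cycles = noCycles ; partition = partition }
    where
    partition : ∀ u v → Adj G u v →
                ∃! _≡_ (λ (o : Occ k p 0) → SameEdge (occEdge paths noCycles o) (u , v))
    partition u v uv with cover u v uv
    ... | c , i , s = inj₁ (c , i) , s , unique
      where
      unique : ∀ {o} → SameEdge (occEdge paths noCycles o) (u , v) → inj₁ (c , i) ≡ o
      unique {inj₁ (c′ , i′)} s′ = cong inj₁ (disjoint c i c′ i′ (SameEdge-trans s (SameEdge-sym s′)))

K-adj? : ∀ n → Decidable (Adj (K n))
K-adj? n i j = ¬? (i ≟ᶠ j)

P-adj? : ∀ k → Decidable (Adj (P k))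
P-adj? k i j = (toℕ j ℕ.≟ suc (toℕ i)) ⊎-dec (toℕ i ℕ.≟ suc (toℕ j))

⊗-adj? : ∀ {G H} → Decidable (Adj G) → Decidable (Adj H) → Decidable (Adj (G ⊗ H))
⊗-adj? G? H? (g₁ , h₁) (g₂ , h₂) = G? g₁ g₂ ×-dec H? h₁ h₂

all×? : ∀ {m n} {P : Fin m × Fin n → Set} → (∀ x → Dec (P x)) → Dec (∀ x → P x)
all×? P? = map′ (λ f (a , i) → f a i) (λ f a i → f (a , i)) (all? λ a → all? λ i → P? (a , i))

injective? : ∀ {n} {A : Set} → DecidableEquality A → (f : Fin n → A) → Dec (Injective _≡_ _≡_ f)
injective? _≟_ f = map′ (λ inj {i} {j} → inj i j) (λ inj i j → inj)
  (all? λ i → all? λ j → (f i ≟ f j) →-dec (i ≟ᶠ j))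

Vertex : Set
Vertex = V (K 3 ⊗ P 4)

_≟_ : DecidableEquality Vertex
_≟_ = ≡-dec _≟ᶠ_ _≟ᶠ_

adj? : Decidable (Adj (K 3 ⊗ P 4))
adj? = ⊗-adj? {K 3} {P 4} (K-adj? 3) (P-adj? 4)

route : Vec (Vec Vertex 9) 3
route =
    ((# 0 , # 0) ∷ (# 1 , # 1) ∷ (# 0 , # 2) ∷ (# 2 , # 1) ∷ (# 1 , # 2) ∷ (# 0 , # 3) ∷ (# 1 , # 4) ∷ (# 2 , # 3) ∷ (# 0 , # 4) ∷ [])
  ∷ ((# 0 , # 0) ∷ (# 2 , # 1) ∷ (# 1 , # 0) ∷ (# 0 , # 1) ∷ (# 2 , # 0) ∷ (# 1 , # 1) ∷ (# 2 , # 2) ∷ (# 1 , # 3) ∷ (# 2 , # 4) ∷ [])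
  ∷ ((# 0 , # 4) ∷ (# 1 , # 3) ∷ (# 0 , # 2) ∷ (# 2 , # 3) ∷ (# 1 , # 2) ∷ (# 0 , # 1) ∷ (# 2 , # 2) ∷ (# 0 , # 3) ∷ (# 2 , # 4) ∷ [])
  ∷ []

routeVertex : Fin 3 → Fin 9 → Vertex
routeVertex c = lookup (lookup route c)

route-injective : ∀ c → Injective _≡_ _≡_ (routeVertex c)
route-injective = toWitness {a? = all? λ c → injective? _≟_ (routeVertex c)} _

route-adjacent : ∀ c (i : Fin 8) → Adj (K 3 ⊗ P 4) (routeVertex c (inject₁ i)) (routeVertex c (fsuc i))
route-adjacent = toWitness {a? = all? λ c → all? λ i → adj? (routeVertex c (inject₁ i)) (routeVertex c (fsuc i))} _

routePath : Fin 3 → PathCopy 8 (K 3 ⊗ P 4)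
routePath c = record { vtx = routeVertex c ; inj = route-injective c ; adj = route-adjacent c }

routes-cover : PathsCover routePath
routes-cover u v = toWitness {a? = all×? λ u → all×? λ v → adj? u v →-dec
  (any? λ c → any? λ i → SameEdge? _≟_ (pathEdge routePath c i) (u , v))} _ u v

routes-edgeDisjoint : PathsEdgeDisjoint routePath
routes-edgeDisjoint = toWitness {a? = all? λ c → all? λ i → all? λ c′ → all? λ i′ →
  SameEdge? _≟_ (pathEdge routePath c i) (pathEdge routePath c′ i′) →-dec
  ≡-dec _≟ᶠ_ _≟ᶠ_ (c , i) (c′ , i′)} _

mainTheorem8 : HasDecomposition 8 (K 3 ⊗ P 4)
mainTheorem8 = 3 , 0 , pathDecomposition routePath routes-cover routes-edgeDisjoint
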